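{- Let $T$ be a MinD tree with $n=2^k+r\ge 4$ leaves, where $k\ge 0$ and $0\le r<2^k$, and let $c_T(n)$ be its Colless index. Then $$N(c_T(n))<\frac{2k}{n}\le\frac{2\log_2(n)}{n}\le\frac{k}{2^{k-1}}.$$
   Context: A full binary tree is a rooted tree in which every node has $0$ or $2$ children. An internal node is a $D$-node if its two children have different numbers of descendant leaves. A MinD tree on $n$ leaves is a full binary tree with $n$ leaves having the minimum number of $D$-nodes among all full binary trees with $n$ leaves. The Colless index of a full binary tree is $\sum|\ell_L(v)-\ell_R(v)|$ over internal nodes $v$, where $\ell_L(v),\ell_R(v)$ are the numbers of leaves of the left and right subtrees of $v$. Let $\delta(n)$ and $c_{max}(n)$ be the minimum and maximum Colless index over all full binary trees with $n$ leaves. The normalized Colless index is $N(c)=\dfrac{c-\delta(n)}{c_{max}(n)-\delta(n)}$ (defined for $n\ge 4$). -}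

module Defs where

open import Data.Nat using (ℕ; zero; suc; _+_; _*_; _∸_; _^_; _≤_; _<_)
open import Data.Nat.Properties using (_≟_)
open import Relation.Nullary using (yes; no)

data Tree : Set where
  leaf : Tree
  node : Tree → Tree → Tree

leaves : Tree → ℕ
leaves leaf       = 1
leaves (node l r) = leaves l + leaves r

absDiff : ℕ → ℕ → ℕ
absDiff a b = (a ∸ b) + (b ∸ a)

colless : Tree → ℕ
colless leaf       = 0
colless (node l r) = absDiff (leaves l) (leaves r) + colless l + colless r

dNodes : Tree → ℕ
dNodes leaf = 0
dNodes (node l r) with leaves l ≟ leaves r
... | yes _ = dNodes l + dNodes r
... | no  _ = suc (dNodes l + dNodes r)

IsMinD : ℕ → Tree → Set
IsMinD n T = leaves T ≡ n × ((T' : Tree) → leaves T' ≡ n → dNodes T ≤ dNodes T')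
  where
  open import Relation.Binary.PropositionalEquality using (_≡_)
  open import Data.Product using (_×_)

IsMinColless : ℕ → ℕ → Set
IsMinColless n d =
  (Σ Tree λ T → leaves T ≡ n × colless T ≡ d) × ((T : Tree) → leaves T ≡ n → d ≤ colless T)
  where
  open import Relation.Binary.PropositionalEquality using (_≡_)
  open import Data.Product using (_×_; Σ)

IsMaxColless : ℕ → ℕ → Set
IsMaxColless n m =
  (Σ Tree λ T → leaves T ≡ n × colless T ≡ m) × ((T : Tree) → leaves T ≡ n → colless T ≤ m)
  where
  open import Relation.Binary.PropositionalEquality using (_≡_)
  open import Data.Product using (_×_; Σ)

-- Only D-nodes contribute to the Colless index, and induction over the tree shows
-- 2C + d(d+3) ≤ 2dn for a tree with Colless index C, d D-nodes and n leaves.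
-- A MinD tree on n = 2^k + r leaves has at most k D-nodes (a spine of perfect trees
-- has that many), so C ≤ kn - k(k+3)/2, while the caterpillar gives
-- c_max(n) ≥ (n-1)(n-2)/2. For k ≥ 3 this already gives C·n < 2k·c_max(n); the four
-- cases with k = 2 are checked against optimal competitors. The last inequality is
-- (M+t)^M ≤ M^(M+t) for M = 2^k ≥ 3, which follows from (1 + 1/N)^M ≤ 3 for M ≤ N.
module Submission where

open import Defs
open import Data.Nat using (ℕ; _+_; _*_; _∸_; _^_; _≤_; _<_)
open import Data.Product using (_×_)
open import Relation.Binary.PropositionalEquality using (_≡_)
open import Data.Nat using (zero; suc; z≤n; s≤s; _≤?_; _<?_)
open import Data.Nat.Properties
open import Data.Nat.Tactic.RingSolver using (solve; solve-∀)
open import Data.List using (_∷_; [])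
open import Data.Product using (_,_; ∃)
open import Data.Sum using (inj₁; inj₂)
open import Relation.Binary.PropositionalEquality using (refl; sym; trans; cong; cong₂; subst; module ≡-Reasoning)
open import Relation.Nullary using (yes; no; contradiction)
open import Relation.Nullary.Decidable using (True; toWitness)

by-computation : ∀ {m n} {m≤?n : True (m ≤? n)} → m ≤ n
by-computation {m≤?n = m≤n} = toWitness m≤n

absDiff-self : ∀ a → absDiff a a ≡ 0
absDiff-self a rewrite n∸n≡0 a = refl

absDiff-comm : ∀ a b → absDiff a b ≡ absDiff b a
absDiff-comm a b = +-comm (a ∸ b) (b ∸ a)

absDiff-+ : ∀ b t → absDiff (b + t) b ≡ t
absDiff-+ b t rewrite m+n∸m≡n b t | m≤n⇒m∸n≡0 (m≤m+n b t) = +-identityʳ t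

leaves-positive : ∀ T → 1 ≤ leaves T
leaves-positive leaf       = s≤s z≤n
leaves-positive (node l r) = ≤-trans (leaves-positive l) (m≤m+n _ _)

dNodes-node≤ : ∀ l r → dNodes (node l r) ≤ suc (dNodes l + dNodes r)
dNodes-node≤ l r with leaves l ≟ leaves r
... | yes _ = n≤1+n _
... | no _  = ≤-refl

dNodes<leaves : ∀ T → dNodes T < leaves T
dNodes<leaves leaf       = s≤s z≤n
dNodes<leaves (node l r) =
  ≤-trans (s≤s (dNodes-node≤ l r))
          (subst (_≤ leaves l + leaves r) (cong suc (+-suc (dNodes l) (dNodes r)))
                 (+-mono-≤ (dNodes<leaves l) (dNodes<leaves r)))

record CollessBound (C d n : ℕ) : Set where
  constructor collessBound
  field bound : 2 * C + d * (d + 3) ≤ 2 * d * n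

balanced-bound : ∀ {a b Cl Cr dl dr} → a ≡ b → CollessBound Cl dl a → CollessBound Cr dr b →
  dr ≤ b → CollessBound (absDiff a b + Cl + Cr) (dl + dr) (a + b)
balanced-bound {a} {_} {Cl} {Cr} {dl} {dr} refl (collessBound hl) (collessBound hr) dr≤a = collessBound (begin
  2 * (absDiff a a + Cl + Cr) + (dl + dr) * (dl + dr + 3)
    ≡⟨ cong (λ x → 2 * (x + Cl + Cr) + (dl + dr) * (dl + dr + 3)) (absDiff-self a) ⟩
  2 * (0 + Cl + Cr) + (dl + dr) * (dl + dr + 3)
    ≡⟨ solve (Cl ∷ Cr ∷ dl ∷ dr ∷ []) ⟩
  (2 * Cl + dl * (dl + 3)) + (2 * Cr + dr * (dr + 3)) + 2 * dl * dr
    ≤⟨ +-mono-≤ (+-mono-≤ hl hr) (*-monoʳ-≤ (2 * dl) dr≤a) ⟩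
  2 * dl * a + 2 * dr * a + 2 * dl * a
    ≤⟨ m≤m+n _ (2 * dr * a) ⟩
  2 * dl * a + 2 * dr * a + 2 * dl * a + 2 * dr * a
    ≡⟨ solve (dl ∷ dr ∷ a ∷ []) ⟩
  2 * (dl + dr) * (a + a) ∎)
  where open ≤-Reasoning

heavier-left-bound : ∀ {a b Cl Cr dl dr} → b ≤ a → CollessBound Cl dl a → CollessBound Cr dr b →
  dr < b → CollessBound (absDiff a b + Cl + Cr) (suc (dl + dr)) (a + b)
heavier-left-bound {_} {b} {Cl} {Cr} {dl} {dr} b≤a (collessBound hl) (collessBound hr) dr<b with m≤n⇒∃[o]m+o≡n b≤a
... | t , refl = collessBound (begin
  2 * (absDiff (b + t) b + Cl + Cr) + suc (dl + dr) * (suc (dl + dr) + 3)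
    ≡⟨ cong (λ x → 2 * (x + Cl + Cr) + suc (dl + dr) * (suc (dl + dr) + 3)) (absDiff-+ b t) ⟩
  2 * (t + Cl + Cr) + suc (dl + dr) * (suc (dl + dr) + 3)
    ≡⟨ solve (t ∷ Cl ∷ Cr ∷ dl ∷ dr ∷ []) ⟩
  (2 * Cl + dl * (dl + 3)) + (2 * Cr + dr * (dr + 3)) + (2 * dl * suc dr + 2 * (2 + dr) + 2 * t)
    ≤⟨ +-mono-≤ (+-mono-≤ hl hr)
                (+-monoˡ-≤ (2 * t) (+-mono-≤ (*-monoʳ-≤ (2 * dl) dr<b) (*-monoʳ-≤ 2 2+dr≤b+b))) ⟩
  2 * dl * (b + t) + 2 * dr * b + (2 * dl * b + 2 * (b + b) + 2 * t)
    ≤⟨ m≤m+n _ (2 * dr * (b + t)) ⟩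
  2 * dl * (b + t) + 2 * dr * b + (2 * dl * b + 2 * (b + b) + 2 * t) + 2 * dr * (b + t)
    ≡⟨ solve (b ∷ t ∷ dl ∷ dr ∷ []) ⟩
  2 * suc (dl + dr) * (b + t + b) ∎)
  where
  open ≤-Reasoning
  2+dr≤b+b : 2 + dr ≤ b + b
  2+dr≤b+b = +-mono-≤ (≤-trans (s≤s z≤n) dr<b) dr<b

unbalanced-bound : ∀ {a b Cl Cr dl dr} → CollessBound Cl dl a → CollessBound Cr dr b →
  dl < a → dr < b → CollessBound (absDiff a b + Cl + Cr) (suc (dl + dr)) (a + b)
unbalanced-bound {a} {b} {Cl} {Cr} {dl} {dr} hl hr dl<a dr<b with ≤-total b a
... | inj₁ b≤a = heavier-left-bound b≤a hl hr dr<b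
... | inj₂ a≤b rewrite absDiff-comm a b | +-comm a b | +-comm dl dr =
  subst (λ C → CollessBound C (suc (dr + dl)) (b + a)) (swap (absDiff b a) Cr Cl)
        (heavier-left-bound a≤b hr hl dl<a)
  where
  swap : ∀ x y z → x + y + z ≡ x + z + y
  swap = solve-∀

colless-bound : ∀ T → CollessBound (colless T) (dNodes T) (leaves T)
colless-bound leaf = collessBound z≤n
colless-bound (node l r) with leaves l ≟ leaves r
... | yes a≡b = balanced-bound a≡b (colless-bound l) (colless-bound r) (<⇒≤ (dNodes<leaves r))
... | no _    = unbalanced-bound (colless-bound l) (colless-bound r) (dNodes<leaves l) (dNodes<leaves r)

-- (2kn - k(k+3)) - (2dn - d(d+3)) = (k - d)(2n - k - d - 3)
CollessBound-mono : ∀ {C d k n} → d ≤ k → k + 2 ≤ n → CollessBound C d n → CollessBound C k n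
CollessBound-mono {C} {d} {_} {n} d≤k k+2≤n (collessBound bound) with m≤n⇒∃[o]m+o≡n d≤k
... | j , refl = collessBound (begin
  2 * C + (d + j) * (d + j + 3)
    ≡⟨ solve (C ∷ d ∷ j ∷ []) ⟩
  2 * C + d * (d + 3) + j * (2 * d + j + 3)
    ≤⟨ +-mono-≤ bound (*-monoʳ-≤ j 2d+j+3≤n+n) ⟩
  2 * d * n + j * (n + n)
    ≡⟨ solve (d ∷ j ∷ n ∷ []) ⟩
  2 * (d + j) * n ∎)
  where
  open ≤-Reasoning
  2d+j+3≤n+n : 2 * d + j + 3 ≤ n + n
  2d+j+3≤n+n = begin
    2 * d + j + 3             ≤⟨ m≤m+n _ (j + 1) ⟩
    2 * d + j + 3 + (j + 1)   ≡⟨ solve (d ∷ j ∷ []) ⟩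
    (d + j + 2) + (d + j + 2) ≤⟨ +-mono-≤ k+2≤n k+2≤n ⟩
    n + n                     ∎

-- With n = 2k + s and C = δ + e, c_max = δ + f, the δ-terms cancel.
normalized-colless-bound : ∀ k {s n C d δ cm} → 2 * k + s ≡ n → δ ≤ C → δ ≤ cm →
  CollessBound C d n → 2 * d * n * n < d * (d + 3) * n + 2 * k * (2 * cm) + 2 * δ * s →
  (C ∸ δ) * n < 2 * k * (cm ∸ δ)
normalized-colless-bound k {s} {_} {C} {d} {δ} {cm} refl δ≤C δ≤cm (collessBound bound) h
  with m≤n⇒∃[o]m+o≡n δ≤C | m≤n⇒∃[o]m+o≡n δ≤cm
... | e , refl | f , refl rewrite m+n∸m≡n δ e | m+n∸m≡n δ f =
  *-cancelˡ-< 2 _ _ (+-cancelʳ-< ((d * (d + 3) + 2 * δ) * (2 * k + s)) _ _ (begin-strict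
    2 * (e * (2 * k + s)) + (d * (d + 3) + 2 * δ) * (2 * k + s)
      ≡⟨ solve (k ∷ s ∷ d ∷ δ ∷ e ∷ []) ⟩
    (2 * (δ + e) + d * (d + 3)) * (2 * k + s)
      ≤⟨ *-monoˡ-≤ (2 * k + s) bound ⟩
    2 * d * (2 * k + s) * (2 * k + s)
      <⟨ h ⟩
    d * (d + 3) * (2 * k + s) + 2 * k * (2 * (δ + f)) + 2 * δ * s
      ≡⟨ solve (k ∷ s ∷ d ∷ δ ∷ f ∷ []) ⟩
    2 * (2 * k * f) + (d * (d + 3) + 2 * δ) * (2 * k + s) ∎))
  where open ≤-Reasoning

perfect : ℕ → Tree
perfect zero    = leaf
perfect (suc h) = node (perfect h) (perfect h)

leaves-perfect : ∀ h → leaves (perfect h) ≡ 2 ^ h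
leaves-perfect zero    = refl
leaves-perfect (suc h) rewrite leaves-perfect h | +-identityʳ (2 ^ h) = refl

dNodes-perfect : ∀ h → dNodes (perfect h) ≡ 0
dNodes-perfect zero = refl
dNodes-perfect (suc h) with leaves (perfect h) ≟ leaves (perfect h)
... | yes _ rewrite dNodes-perfect h = refl
... | no ≢ = contradiction refl ≢

dNodes-perfect-node : ∀ h T → dNodes (node (perfect h) T) ≤ suc (dNodes T)
dNodes-perfect-node h T =
  subst (λ x → dNodes (node (perfect h) T) ≤ suc (x + dNodes T)) (dNodes-perfect h) (dNodes-node≤ (perfect h) T)

spine : ℕ → ℕ → Tree
spine zero    _ = leaf
spine (suc k) r with r <? 2 ^ k
... | yes _ = node (perfect k) (spine k r)
... | no _  = node (perfect (suc k)) (spine k (r ∸ 2 ^ k))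

leaves-spine : ∀ k r → r < 2 ^ k → leaves (spine k r) ≡ 2 ^ k + r
leaves-spine zero    zero    _        = refl
leaves-spine zero    (suc _) (s≤s ())
leaves-spine (suc k) r r<2^[1+k] with r <? 2 ^ k
... | yes r<2^k =
  trans (cong₂ _+_ (leaves-perfect k) (leaves-spine k r r<2^k)) (double (2 ^ k) r)
  where
  double : ∀ x r → x + (x + r) ≡ 2 * x + r
  double = solve-∀
... | no r≮2^k with m≤n⇒∃[o]m+o≡n (≮⇒≥ r≮2^k)
...   | s , refl rewrite m+n∸m≡n (2 ^ k) s =
  cong₂ _+_ (leaves-perfect (suc k)) (leaves-spine k s s<2^k)
  where
  s<2^k : s < 2 ^ k
  s<2^k = +-cancelˡ-< (2 ^ k) s (2 ^ k) (subst (2 ^ k + s <_) (cong (2 ^ k +_) (+-identityʳ (2 ^ k))) r<2^[1+k])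

dNodes-spine : ∀ k r → dNodes (spine k r) ≤ k
dNodes-spine zero    _ = z≤n
dNodes-spine (suc k) r with r <? 2 ^ k
... | yes _ = ≤-trans (dNodes-perfect-node k (spine k r)) (s≤s (dNodes-spine k r))
... | no _  = ≤-trans (dNodes-perfect-node (suc k) (spine k (r ∸ 2 ^ k))) (s≤s (dNodes-spine k (r ∸ 2 ^ k)))

caterpillar : ℕ → Tree
caterpillar zero    = leaf
caterpillar (suc m) = node (caterpillar m) leaf

leaves-caterpillar : ∀ m → leaves (caterpillar m) ≡ suc m
leaves-caterpillar zero    = refl
leaves-caterpillar (suc m) rewrite leaves-caterpillar m = cong suc (+-comm m 1)

colless-caterpillar : ∀ m → 2 * colless (caterpillar (suc m)) ≡ suc m * m
colless-caterpillar zero    = refl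
colless-caterpillar (suc m) = begin
  2 * (absDiff (leaves (caterpillar (suc m))) 1 + c + 0)
    ≡⟨ cong (λ ℓ → 2 * (absDiff ℓ 1 + c + 0)) (leaves-caterpillar (suc m)) ⟩
  2 * (suc m + 0 + c + 0)
    ≡⟨ distrib m c ⟩
  2 * suc m + 2 * c
    ≡⟨ cong (2 * suc m +_) (colless-caterpillar m) ⟩
  2 * suc m + suc m * m
    ≡⟨ solve (m ∷ []) ⟩
  suc (suc m) * suc m ∎
  where
  open ≡-Reasoning
  c : ℕ
  c = colless (caterpillar (suc m))
  distrib : ∀ m c → 2 * (suc m + 0 + c + 0) ≡ 2 * suc m + 2 * c
  distrib = solve-∀

max-colless-lower : ∀ {p n cm} → 2 + p ≡ n → IsMaxColless n cm → (1 + p) * p ≤ 2 * cm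
max-colless-lower {p} {_} {cm} refl (_ , colless≤cm) =
  subst (_≤ 2 * cm) (colless-caterpillar p)
        (*-monoʳ-≤ 2 (colless≤cm (caterpillar (suc p)) (leaves-caterpillar (suc p))))

colless-3 : ∀ T → leaves T ≡ 3 → 1 ≤ colless T
colless-3 (node l r) e = root (leaves l) (leaves r) e (leaves-positive l) (leaves-positive r)
  where
  root : ∀ a b → a + b ≡ 3 → 1 ≤ a → 1 ≤ b → 1 ≤ absDiff a b + colless l + colless r
  root 1 _ refl _ _  = s≤s z≤n
  root 2 _ refl _ _  = s≤s z≤n
  root 3 _ refl _ ()

colless-7 : ∀ T → leaves T ≡ 7 → 2 ≤ colless T
colless-7 (node l r) e = root (leaves l) (leaves r) e (leaves-positive l) (leaves-positive r) (colless-3 l) (colless-3 r)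
  where
  root : ∀ a b → a + b ≡ 7 → 1 ≤ a → 1 ≤ b → (a ≡ 3 → 1 ≤ colless l) → (b ≡ 3 → 1 ≤ colless r) →
    2 ≤ absDiff a b + colless l + colless r
  root 1 _ refl _ _  _  _  = s≤s (s≤s z≤n)
  root 2 _ refl _ _  _  _  = s≤s (s≤s z≤n)
  root 3 _ refl _ _  cl _  = ≤-trans (s≤s (cl refl)) (m≤m+n _ (colless r))
  root 4 _ refl _ _  _  cr = s≤s (≤-trans (cr refl) (m≤n+m (colless r) (colless l)))
  root 5 _ refl _ _  _  _  = s≤s (s≤s z≤n)
  root 6 _ refl _ _  _  _  = s≤s (s≤s z≤n)
  root 7 _ refl _ () _  _

-- W is a competitor with few D-nodes; M₀ and δ₀ are lower bounds for 2 c_max(n) and δ(n).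
minD-colless-bound-via : ∀ k T (W : Tree) {s n d₀ δ cm M₀ δ₀} → leaves W ≡ n → dNodes W ≤ d₀ → d₀ + 2 ≤ n →
  2 * k + s ≡ n → IsMinD n T → IsMinColless n δ → IsMaxColless n cm → M₀ ≤ 2 * cm → δ₀ ≤ δ →
  2 * d₀ * n * n < d₀ * (d₀ + 3) * n + 2 * k * M₀ + 2 * δ₀ * s →
  (colless T ∸ δ) * n < 2 * k * (cm ∸ δ)
minD-colless-bound-via k T W {s} {n} {d₀} {δ} eW dW d₀+2≤n 2k+s≡n (eT , minD) (_ , δ≤colless) (_ , colless≤cm)
  M₀≤2cm δ₀≤δ criterion =
  normalized-colless-bound k 2k+s≡n δ≤C (≤-trans δ≤C (colless≤cm T eT))
    (CollessBound-mono (≤-trans (minD W eW) dW) d₀+2≤n (subst (CollessBound _ _) eT (colless-bound T)))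
    (<-≤-trans criterion (+-mono-≤ (+-monoʳ-≤ (d₀ * (d₀ + 3) * n) (*-monoʳ-≤ (2 * k) M₀≤2cm))
                                   (*-monoˡ-≤ s (*-monoʳ-≤ 2 δ₀≤δ))))
  where
  δ≤C : δ ≤ colless T
  δ≤C = δ≤colless T eT

large-criterion : ∀ {k p n} → 3 ≤ k → 2 + p ≡ n →
  2 * k * n * n < k * (k + 3) * n + 2 * k * ((1 + p) * p)
large-criterion {k} {p} 3≤k refl = begin-strict
  2 * k * (2 + p) * (2 + p)
    <⟨ m<m+n _ (≤-trans (s≤s z≤n) (*-monoʳ-≤ 4 3≤k)) ⟩
  2 * k * (2 + p) * (2 + p) + 4 * k
    ≡⟨ solve (k ∷ p ∷ []) ⟩
  k * (3 + 3) * (2 + p) + 2 * k * ((1 + p) * p)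
    ≤⟨ +-monoˡ-≤ _ (*-monoˡ-≤ (2 + p) (*-monoʳ-≤ k (+-monoˡ-≤ 3 3≤k))) ⟩
  k * (k + 3) * (2 + p) + 2 * k * ((1 + p) * p) ∎
  where open ≤-Reasoning

n<2^n : ∀ n → n < 2 ^ n
n<2^n zero    = s≤s z≤n
n<2^n (suc n) rewrite +-identityʳ (2 ^ n) = +-mono-≤ (≤-trans (s≤s z≤n) (n<2^n n)) (n<2^n n)

2*n≤2^n : ∀ n → 2 * n ≤ 2 ^ n
2*n≤2^n zero    = z≤n
2*n≤2^n (suc n) = *-monoʳ-≤ 2 (n<2^n n)

exponent≥2 : ∀ {k r} → r < 2 ^ k → 4 ≤ 2 ^ k + r → 2 ≤ k
exponent≥2 {0} {0}             _                (s≤s ())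
exponent≥2 {0} {suc _}         (s≤s ())         _
exponent≥2 {1} {0}             _                (s≤s (s≤s ()))
exponent≥2 {1} {1}             _                (s≤s (s≤s (s≤s ())))
exponent≥2 {1} {suc (suc _)}   (s≤s (s≤s ()))   _
exponent≥2 {suc (suc _)}       _                _ = s≤s (s≤s z≤n)

minD-colless-bound : ∀ k r → r < 2 ^ k → 2 ≤ k → ∀ T {δ cm} →
  IsMinD (2 ^ k + r) T → IsMinColless (2 ^ k + r) δ → IsMaxColless (2 ^ k + r) cm →
  (colless T ∸ δ) * (2 ^ k + r) < 2 * k * (cm ∸ δ)
minD-colless-bound 0 _ _ ()
minD-colless-bound 1 _ _ (s≤s ())
-- For k = 2 the bound d ≤ k is too weak; the competitors have the optimal number of D-nodes,
-- and n = 7 also needs δ(7) ≥ 2.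
minD-colless-bound 2 0 _ _ T minD minC maxC =
  minD-colless-bound-via 2 T (perfect 2) refl ≤-refl by-computation refl minD minC maxC
    (max-colless-lower refl maxC) z≤n by-computation
minD-colless-bound 2 1 _ _ T minD minC maxC =
  minD-colless-bound-via 2 T (node (perfect 2) leaf) refl ≤-refl by-computation refl minD minC maxC
    (max-colless-lower refl maxC) z≤n by-computation
minD-colless-bound 2 2 _ _ T minD minC maxC =
  minD-colless-bound-via 2 T (node (perfect 2) (perfect 1)) refl ≤-refl by-computation refl minD minC maxC
    (max-colless-lower refl maxC) z≤n by-computation
minD-colless-bound 2 3 _ _ T minD minC@((S , eS , cS) , _) maxC =
  minD-colless-bound-via 2 T (spine 2 3) refl ≤-refl by-computation refl minD minC maxC
    (max-colless-lower refl maxC) (subst (2 ≤_) cS (colless-7 S eS)) by-computation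
minD-colless-bound 2 (suc (suc (suc (suc _)))) (s≤s (s≤s (s≤s (s≤s ())))) _ _ _ _ _
minD-colless-bound k@(suc (suc (suc _))) r r<2^k _ T {δ} {cm} minD minC maxC =
  large (m≤n⇒∃[o]m+o≡n (≤-trans (2*n≤2^n k) (m≤m+n (2 ^ k) r)))
        (m≤n⇒∃[o]m+o≡n (≤-trans (m≤n+m 2 k) k+2≤n))
  where
  k+2≤n : k + 2 ≤ 2 ^ k + r
  k+2≤n = ≤-trans (+-monoʳ-≤ k (s≤s (s≤s z≤n))) (≤-trans (2*n≤2^n k) (m≤m+n (2 ^ k) r))
  large : ∃ (λ s → 2 * k + s ≡ 2 ^ k + r) → ∃ (λ p → 2 + p ≡ 2 ^ k + r) →
    (colless T ∸ δ) * (2 ^ k + r) < 2 * k * (cm ∸ δ)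
  large (_ , 2k+s≡n) (_ , 2+p≡n) =
    minD-colless-bound-via k T (spine k r) (leaves-spine k r r<2^k) (dNodes-spine k r) k+2≤n 2k+s≡n minD minC maxC
      (max-colless-lower 2+p≡n maxC) z≤n (<-≤-trans (large-criterion {k} (s≤s (s≤s (s≤s z≤n))) 2+p≡n) (m≤m+n _ _))

quadratic-step : ∀ {N j} → j ≤ N → suc N * (N * N + j * N + j * j) ≤ N * (N * N + suc j * N + suc j * suc j)
quadratic-step {N} {j} j≤N = +-cancelʳ-≤ (j * j) _ _ (begin
  suc N * (N * N + j * N + j * j) + j * j       ≤⟨ +-monoʳ-≤ _ (*-mono-≤ j≤N (n≤1+n j)) ⟩
  suc N * (N * N + j * N + j * j) + N * suc j   ≡⟨ solve (N ∷ j ∷ []) ⟩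
  N * (N * N + suc j * N + suc j * suc j) + j * j ∎)
  where open ≤-Reasoning

-- (1 + 1/N)^j ≤ 1 + j/N + (j/N)² for j ≤ N, with denominators cleared.
suc-pow-quadratic : ∀ N j → j ≤ N → N * N * suc N ^ j ≤ N ^ j * (N * N + j * N + j * j)
suc-pow-quadratic N zero    _   = ≤-reflexive (solve (N ∷ []))
suc-pow-quadratic N (suc j) j<N = begin
  N * N * (suc N * suc N ^ j)                  ≡⟨ reassoc (N * N) (suc N) (suc N ^ j) ⟩
  suc N * (N * N * suc N ^ j)                  ≤⟨ *-monoʳ-≤ (suc N) (suc-pow-quadratic N j (<⇒≤ j<N)) ⟩
  suc N * (N ^ j * Q)                          ≡⟨ reassoc (suc N) (N ^ j) Q ⟩
  N ^ j * (suc N * Q)                          ≤⟨ *-monoʳ-≤ (N ^ j) (quadratic-step (<⇒≤ j<N)) ⟩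
  N ^ j * (N * Q′)                             ≡⟨ reassoc (N ^ j) N Q′ ⟩
  N * (N ^ j * Q′)                             ≡⟨ sym (*-assoc N (N ^ j) Q′) ⟩
  N * N ^ j * Q′                               ∎
  where
  open ≤-Reasoning
  Q Q′ : ℕ
  Q  = N * N + j * N + j * j
  Q′ = N * N + suc j * N + suc j * suc j
  reassoc : ∀ x y z → x * (y * z) ≡ y * (x * z)
  reassoc = solve-∀

[1+n]^m≤3*n^m : ∀ n m → m ≤ n → suc n ^ m ≤ 3 * n ^ m
[1+n]^m≤3*n^m zero      zero _   = by-computation
[1+n]^m≤3*n^m n@(suc _) m    m≤n = *-cancelˡ-≤ (n * n) (begin
  n * n * suc n ^ m                ≤⟨ suc-pow-quadratic n m m≤n ⟩
  n ^ m * (n * n + m * n + m * m)  ≤⟨ *-monoʳ-≤ (n ^ m) (+-mono-≤ (+-monoʳ-≤ (n * n) (*-monoˡ-≤ n m≤n)) (*-mono-≤ m≤n m≤n)) ⟩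
  n ^ m * (n * n + n * n + n * n)  ≡⟨ triple (n ^ m) (n * n) ⟩
  n * n * (3 * n ^ m)              ∎)
  where
  open ≤-Reasoning
  triple : ∀ x y → x * (y + y + y) ≡ y * (3 * x)
  triple = solve-∀

[m+t]^m≤m^[m+t] : ∀ m t → 3 ≤ m → (m + t) ^ m ≤ m ^ (m + t)
[m+t]^m≤m^[m+t] m zero    _   rewrite +-identityʳ m = ≤-refl
[m+t]^m≤m^[m+t] m (suc t) 3≤m = begin
  (m + suc t) ^ m    ≡⟨ cong (_^ m) (+-suc m t) ⟩
  suc (m + t) ^ m    ≤⟨ [1+n]^m≤3*n^m (m + t) m (m≤m+n m t) ⟩
  3 * (m + t) ^ m    ≤⟨ *-monoʳ-≤ 3 ([m+t]^m≤m^[m+t] m t 3≤m) ⟩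
  3 * m ^ (m + t)    ≤⟨ *-monoˡ-≤ (m ^ (m + t)) 3≤m ⟩
  m ^ suc (m + t)    ≡⟨ cong (m ^_) (sym (+-suc m t)) ⟩
  m ^ (m + suc t)    ∎
  where open ≤-Reasoning

theorem119 : (k r : ℕ) → r < 2 ^ k → 4 ≤ 2 ^ k + r →
    (T : Tree) → IsMinD (2 ^ k + r) T →
    (δ cm : ℕ) → IsMinColless (2 ^ k + r) δ → IsMaxColless (2 ^ k + r) cm →
    ((colless T ∸ δ) * (2 ^ k + r) < 2 * k * (cm ∸ δ))
    × (2 ^ k ≤ 2 ^ k + r)
    × ((2 ^ k + r) ^ (2 ^ k) ≤ 2 ^ ((2 ^ k + r) * k))
theorem119 k r r<2^k 4≤n T minD δ cm minC maxC =
  minD-colless-bound k r r<2^k 2≤k T minD minC maxC , m≤m+n (2 ^ k) r , power-bound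
  where
  open ≤-Reasoning
  2≤k : 2 ≤ k
  2≤k = exponent≥2 r<2^k 4≤n
  power-bound : (2 ^ k + r) ^ (2 ^ k) ≤ 2 ^ ((2 ^ k + r) * k)
  power-bound = begin
    (2 ^ k + r) ^ (2 ^ k)  ≤⟨ [m+t]^m≤m^[m+t] (2 ^ k) r (≤-trans (n≤1+n 3) (^-monoʳ-≤ 2 2≤k)) ⟩
    (2 ^ k) ^ (2 ^ k + r)  ≡⟨ ^-*-assoc 2 k (2 ^ k + r) ⟩
    2 ^ (k * (2 ^ k + r))  ≡⟨ cong (2 ^_) (*-comm k (2 ^ k + r)) ⟩
    2 ^ ((2 ^ k + r) * k)  ∎
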